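{- Let $\mathcal B$ be a board and $\mathsf P$ a one-move rider with basic move $m=(c,d)$. The denominator of the inside-out polytope $(\mathcal B^q,\mathcal A_{\mathsf P})$ equals the least common denominator of the corners of $\mathcal B$ when $q=1$, and, when $q\ge2$, it equals the least common denominator of the corners of $\mathcal B$ together with their antipodes.
   Context: A board $\mathcal B\subset\mathbb R^2$ is a convex polygon with rational corners (vertices). A one-move rider has a single basic move $m=(c,d)\in\mathbb Z^2\setminus\{0\}$ with $\gcd(c,d)=1$. For a corner $z$ of $\mathcal B$, the line through $z$ parallel to $m$ may pass through another point of the boundary of $\mathcal B$; that point is the antipode of $z$ (it may be another corner). When $m$ is parallel to an edge $z_iz_j$ of $\mathcal B$, $z_i$ and $z_j$ are considered each other's antipodes. For $q$ pieces, configurations are points $\mathbf z=(z_1,\dots,z_q)\in\mathbb R^{2q}$; the move hyperplanes are $\mathcal H_{ij}=\{\mathbf z:(z_j-z_i)\cdot(d,-c)=0\}$, $1\le i<j\le q$, forming $\mathcal A_{\mathsf P}$. A vertex of $(\mathcal B^q,\mathcal A_{\mathsf P})$ is a point of $\mathcal B^q$ that is the unique point of an intersection of move hyperplanes and facet hyperplanes $\{\mathbf z:z_i\in\mathcal E\}$ ($\mathcal E$ an edge line of $\mathcal B$). The denominator of the inside-out polytope is the least common multiple, over all vertices, of the least common denominator of the vertex's coordinates. -}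

module Defs where

open import Data.Nat as ℕ using (ℕ; suc; _∸_)
open import Data.Nat.DivMod using (_mod_)
open import Data.Nat.GCD using (gcd)
open import Data.Nat.LCM using (lcm)
open import Data.Nat.Divisibility using (_∣_)
open import Data.Integer as ℤ using (ℤ; ∣_∣)
open import Data.Rational using (ℚ; _+_; _-_; _*_; _<_; _≤_; 0ℚ; ↧ₙ_) renaming (_/_ to _÷_)
open import Data.Fin using (Fin; toℕ)
open import Data.List using (List; foldr; allFin)
open import Data.List.Relation.Unary.All using (All)
open import Data.Product using (_×_; _,_; Σ; ∃)
open import Data.Sum using (_⊎_)
open import Relation.Binary.PropositionalEquality using (_≡_; _≢_)
open import Relation.Nullary using (¬_)

Pt : Set
Pt = ℚ × ℚ

_-ₚ_ : Pt → Pt → Pt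
(a , b) -ₚ (c , d) = (a - c , b - d)

cross : Pt → Pt → ℚ
cross (a , b) (c , d) = a * d - b * c

-- A board: a convex polygon with rational corners z_0, …, z_{n-1}
-- (n = 3 + k), listed counterclockwise, strictly convex: every corner
-- other than the endpoints of an edge lies strictly to the left of that edge.
record Board : Set where
  field
    k      : ℕ
    corner : Fin (3 ℕ.+ k) → Pt

  n : ℕ
  n = 3 ℕ.+ k

  next : Fin n → Fin n
  next i = suc (toℕ i) mod n

  prev : Fin n → Fin n
  prev i = (toℕ i ℕ.+ (n ∸ 1)) mod n

  -- the line of the edge z_e z_{e+1}, as a function whose zero set it is
  edgeForm : Fin n → Pt → ℚ
  edgeForm e z = cross (corner (next e) -ₚ corner e) (z -ₚ corner e)

  field
    strictlyConvex : ∀ e j → j ≢ e → j ≢ next e → 0ℚ < edgeForm e (corner j)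

  InBoard : Pt → Set
  InBoard z = ∀ e → 0ℚ ≤ edgeForm e z

  OnEdgeLine : Fin n → Pt → Set
  OnEdgeLine e z = edgeForm e z ≡ 0ℚ

  OnBoundary : Pt → Set
  OnBoundary z = InBoard z × Σ (Fin n) λ e → OnEdgeLine e z

-- A one-move rider: basic move m = (c , d) ∈ ℤ², gcd(c,d) = 1 (so m ≠ 0).
record Move : Set where
  field
    c d    : ℤ
    coprime : gcd ∣ c ∣ ∣ d ∣ ≡ 1

  vec : Pt
  vec = (c ÷ 1 , d ÷ 1)

  Parallel : Pt → Set
  Parallel v = cross vec v ≡ 0ℚ

  MoveRel : Pt → Pt → Set
  MoveRel zi zj = ((d ÷ 1) * Data.Product.proj₁ (zj -ₚ zi)) - ((c ÷ 1) * Data.Product.proj₂ (zj -ₚ zi)) ≡ 0ℚ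

module _ (B : Board) (m : Move) where
  open Board B
  open Move m

  Antipode : Fin n → Pt → Set
  Antipode i w =
      (Parallel (corner (next i) -ₚ corner i) × w ≡ corner (next i))
    ⊎ (Parallel (corner i -ₚ corner (prev i)) × w ≡ corner (prev i))
    ⊎ (¬ Parallel (corner (next i) -ₚ corner i) × ¬ Parallel (corner i -ₚ corner (prev i))
       × OnBoundary w × w ≢ corner i × Parallel (w -ₚ corner i))

  IsCorner : Pt → Set
  IsCorner w = Σ (Fin n) λ i → w ≡ corner i

  IsCornerOrAntipode : Pt → Set
  IsCornerOrAntipode w = IsCorner w ⊎ Σ (Fin n) λ i → Antipode i w

  Config : ℕ → Set
  Config q = Fin q → Pt

  Satisfies : ∀ {q} → List (Fin q × Fin q) → List (Fin q × Fin n) → Config q → Set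
  Satisfies M F z =
    All (λ { (i , j) → MoveRel (z i) (z j) }) M × All (λ { (i , e) → OnEdgeLine e (z i) }) F

  IsVertex : (q : ℕ) → Config q → Set
  IsVertex q z =
    (∀ i → InBoard (z i)) ×
    Σ (List (Fin q × Fin q)) λ M → Σ (List (Fin q × Fin n)) λ F →
      Satisfies M F z × (∀ w → Satisfies M F w → ∀ i → w i ≡ z i)

ptDen : Pt → ℕ
ptDen (a , b) = lcm (↧ₙ a) (↧ₙ b)

cfgDen : ∀ {q} → (Fin q → Pt) → ℕ
cfgDen {q} z = foldr (λ i acc → lcm (ptDen (z i)) acc) 1 (allFin q)

IsLCMOver : {A : Set} → (A → Set) → (A → ℕ) → ℕ → Set
IsLCMOver {A} P f D =
  (∀ x → P x → f x ∣ D) × (∀ N → (∀ x → P x → f x ∣ N) → D ∣ N)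

IsIOPDenominator : Board → Move → (q : ℕ) → ℕ → Set
IsIOPDenominator B m q D = IsLCMOver (IsVertex B m q) cfgDen D

module Submission where

open import Data.Empty using (⊥; ⊥-elim)
open import Data.Fin using (Fin; toℕ; zero; suc)
open import Data.Fin.Properties using (_≟_; toℕ-fromℕ<; toℕ<n; toℕ-injective)
open import Data.Integer as ℤ using (ℤ)
open import Data.Integer.GCD as ℤ using ()
open import Data.List using (List; []; _∷_; _++_; map; foldr; allFin)
open import Data.List.Membership.Propositional using (_∈_; find; lose)
open import Data.List.Membership.Propositional.Properties using (∈-allFin; ∈-map⁺; ∈-++⁺ˡ; ∈-++⁺ʳ)
open import Data.List.Relation.Unary.All as All using (All)
import Data.List.Relation.Unary.All.Properties as All
open import Data.List.Relation.Unary.Any as Any using (Any; here; there)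
open import Data.Nat as ℕ using (ℕ; _∸_; _≤_; NonZero; z<s; s≤s; z≤n)
open import Data.Nat.Divisibility using (_∣_; ∣-trans; 1∣_)
open import Data.Nat.DivMod using (_mod_; _%_; %-distribˡ-+; m%n%n≡m%n; [m+n]%n≡m%n; m<n⇒m%n≡m)
open import Data.Nat.GCD using (gcd; gcd[0,0]≡0)
open import Data.Nat.LCM using (lcm; m∣lcm[m,n]; n∣lcm[m,n]; lcm-least)
open import Data.Nat.Properties
  using (0≢1+n; +-suc; +-comm; +-cancelʳ-≡; +-cancelˡ-<; +-mono-<; <⇒≢; ≮⇒≥; m≤n⇒∃[o]m+o≡n)
open import Data.Product using (Σ; _×_; _,_; proj₁; proj₂)
open import Data.Product.Properties using (≡-dec)
open import Data.Rational as ℚ using (ℚ; 0ℚ; 1ℚ; _+_; _-_; _*_; -_; 1/_; _/_; ↥_; ≢-nonZero; nonNegative; positive)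
open import Data.Rational.Solver using (module +-*-Solver)
open import Data.Rational.Properties
  using ( +-identityˡ; +-identityʳ; +-inverseʳ; *-identityˡ; *-assoc; *-zeroˡ; *-zeroʳ; *-inverseˡ; 1≢0; ↥-/
        ; <-irrefl; <⇒≤; ≤-reflexive; <-≤-trans; <-cmp
        ; *-monoʳ-≤-nonNeg; *-monoʳ-<-pos; +-mono-≤-<; *-cancelʳ-≤-pos)
  renaming (_≟_ to _≟ℚ_)
open +-*-Solver using (solve; _:=_; _:+_; _:-_; _:*_; :-_; con)
open import Data.Sum using (_⊎_; inj₁; inj₂)
open import Function using (id)
open import Function.Bundles using (_⇔_; mk⇔)
open import Relation.Binary.Definitions using (tri<; tri≈; tri>)
open import Relation.Binary.PropositionalEquality
open import Relation.Nullary using (Dec; yes; no; ¬_)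
open import Relation.Nullary.Decidable using (_×-dec_; ¬?; decidable-stable)

open import Defs

-- Every corner is a vertex coordinate for every q (pile all pieces on it, pinned by its two edge
-- lines), and for q ≥ 2 so is every antipode w of a corner z_i whose two edges are transverse to m:
-- one piece sits at w on its edge line and is tied by a move hyperplane to a piece pinned at z_i.
-- Conversely, at a vertex every piece z_a lies on an edge line transverse to m, for otherwise z_a
-- alone could slide along m. Moreover some piece on the line through z_a parallel to m lies on two
-- crossing edge lines, i.e. on a corner z_i: otherwise all pieces on that line could slide along
-- their edges, at speeds with equal components across m, keeping every move hyperplane. A boundary
-- point on the line through z_i parallel to m is z_i, a corner, or an antipode of z_i. So the vertex
-- coordinates are the corners (q = 1), respectively the corners and antipodes (q ≥ 2), and the two
-- least common multiples of denominators agree.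

-- Arithmetic modulo n

[m%d+n]%d≡[m+n]%d : ∀ m n d .{{_ : NonZero d}} → (m % d ℕ.+ n) % d ≡ (m ℕ.+ n) % d
[m%d+n]%d≡[m+n]%d m n d = begin
  (m % d ℕ.+ n) % d          ≡⟨ %-distribˡ-+ (m % d) n d ⟩
  (m % d % d ℕ.+ n % d) % d  ≡⟨ cong (λ x → (x ℕ.+ n % d) % d) (m%n%n≡m%n m d) ⟩
  (m % d ℕ.+ n % d) % d      ≡⟨ %-distribˡ-+ m n d ⟨
  (m ℕ.+ n) % d              ∎
  where open ≡-Reasoning

[m+n%d]%d≡[m+n]%d : ∀ m n d .{{_ : NonZero d}} → (m ℕ.+ n % d) % d ≡ (m ℕ.+ n) % d
[m+n%d]%d≡[m+n]%d m n d = begin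
  (m ℕ.+ n % d) % d  ≡⟨ cong (_% d) (+-comm m (n % d)) ⟩
  (n % d ℕ.+ m) % d  ≡⟨ [m%d+n]%d≡[m+n]%d n m d ⟩
  (n ℕ.+ m) % d      ≡⟨ cong (_% d) (+-comm n m) ⟩
  (m ℕ.+ n) % d      ∎
  where open ≡-Reasoning

[r+x]%d≢x : ∀ {r x d} .{{_ : NonZero d}} → 0 ℕ.< r → r ℕ.< d → x ℕ.< d → (r ℕ.+ x) % d ≢ x
[r+x]%d≢x {r} {x} {d} 0<r r<d x<d eq with r ℕ.+ x ℕ.<? d
... | yes r+x<d = <⇒≢ 0<r (sym (+-cancelʳ-≡ x r 0 (trans (sym (m<n⇒m%n≡m r+x<d)) eq)))
... | no r+x≮d with m≤n⇒∃[o]m+o≡n (≮⇒≥ r+x≮d)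
...   | y , d+y≡r+x = <⇒≢ r<d (+-cancelʳ-≡ x r d (trans (sym d+y≡r+x) (cong (d ℕ.+_) y≡x)))
  where
    y<d : y ℕ.< d
    y<d = +-cancelˡ-< d y d (subst (ℕ._< d ℕ.+ d) (sym d+y≡r+x) (+-mono-< r<d x<d))
    y≡x : y ≡ x
    y≡x = begin
      y              ≡⟨ m<n⇒m%n≡m y<d ⟨
      y % d          ≡⟨ [m+n]%n≡m%n y d ⟨
      (y ℕ.+ d) % d  ≡⟨ cong (_% d) (trans (+-comm y d) d+y≡r+x) ⟩
      (r ℕ.+ x) % d  ≡⟨ eq ⟩
      x              ∎
      where open ≡-Reasoning

-- Board.next and Board.prev unfold to next and prev below, so these lemmas apply to every board.
module Cyclic (k : ℕ) where
  private
    n : ℕ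
    n = 3 ℕ.+ k

  next prev : Fin n → Fin n
  next i = ℕ.suc (toℕ i) mod n
  prev i = (toℕ i ℕ.+ (n ∸ 1)) mod n

  toℕ-next : ∀ i → toℕ (next i) ≡ (1 ℕ.+ toℕ i) % n
  toℕ-next i = toℕ-fromℕ< _

  toℕ-prev : ∀ i → toℕ (prev i) ≡ (toℕ i ℕ.+ (n ∸ 1)) % n
  toℕ-prev i = toℕ-fromℕ< _

  toℕ-next² : ∀ i → toℕ (next (next i)) ≡ (2 ℕ.+ toℕ i) % n
  toℕ-next² i = trans (toℕ-next (next i))
    (trans (cong (λ x → (1 ℕ.+ x) % n) (toℕ-next i)) ([m+n%d]%d≡[m+n]%d 1 (1 ℕ.+ toℕ i) n))

  private
    [x+n]%n≡x : ∀ i → (toℕ i ℕ.+ n) % n ≡ toℕ i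
    [x+n]%n≡x i = trans ([m+n]%n≡m%n (toℕ i) n) (m<n⇒m%n≡m (toℕ<n i))

  next-prev : ∀ i → next (prev i) ≡ i
  next-prev i = toℕ-injective (begin
    toℕ (next (prev i))                  ≡⟨ toℕ-next (prev i) ⟩
    (1 ℕ.+ toℕ (prev i)) % n             ≡⟨ cong (λ x → (1 ℕ.+ x) % n) (toℕ-prev i) ⟩
    (1 ℕ.+ (toℕ i ℕ.+ (n ∸ 1)) % n) % n  ≡⟨ [m+n%d]%d≡[m+n]%d 1 (toℕ i ℕ.+ (n ∸ 1)) n ⟩
    ℕ.suc (toℕ i ℕ.+ (n ∸ 1)) % n        ≡⟨ cong (_% n) (+-suc (toℕ i) (n ∸ 1)) ⟨
    (toℕ i ℕ.+ n) % n                    ≡⟨ [x+n]%n≡x i ⟩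
    toℕ i                                ∎)
    where open ≡-Reasoning

  prev-next : ∀ i → prev (next i) ≡ i
  prev-next i = toℕ-injective (begin
    toℕ (prev (next i))                  ≡⟨ toℕ-prev (next i) ⟩
    (toℕ (next i) ℕ.+ (n ∸ 1)) % n       ≡⟨ cong (λ x → (x ℕ.+ (n ∸ 1)) % n) (toℕ-next i) ⟩
    ((1 ℕ.+ toℕ i) % n ℕ.+ (n ∸ 1)) % n  ≡⟨ [m%d+n]%d≡[m+n]%d (1 ℕ.+ toℕ i) (n ∸ 1) n ⟩
    ℕ.suc (toℕ i ℕ.+ (n ∸ 1)) % n        ≡⟨ cong (_% n) (+-suc (toℕ i) (n ∸ 1)) ⟨
    (toℕ i ℕ.+ n) % n                    ≡⟨ [x+n]%n≡x i ⟩
    toℕ i                                ∎)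
    where open ≡-Reasoning

  next-injective : ∀ {i j} → next i ≡ next j → i ≡ j
  next-injective {i} {j} eq = trans (sym (prev-next i)) (trans (cong prev eq) (prev-next j))

  next≢id : ∀ i → next i ≢ i
  next≢id i eq = [r+x]%d≢x {1} z<s (s≤s (s≤s z≤n)) (toℕ<n i) (trans (sym (toℕ-next i)) (cong toℕ eq))

  next²≢id : ∀ i → next (next i) ≢ i
  next²≢id i eq = [r+x]%d≢x {2} z<s (s≤s (s≤s (s≤s z≤n))) (toℕ<n i) (trans (sym (toℕ-next² i)) (cong toℕ eq))

  next≢prev : ∀ i → next i ≢ prev i
  next≢prev i eq = next²≢id i (trans (cong next eq) (next-prev i))

-- Rationals and plane vectors

x*y≡0⇒y≡0 : ∀ {x y} → x ≢ 0ℚ → x * y ≡ 0ℚ → y ≡ 0ℚ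
x*y≡0⇒y≡0 {x} {y} x≢0 xy≡0 = begin
  y              ≡⟨ *-identityˡ y ⟨
  1ℚ * y         ≡⟨ cong (_* y) (*-inverseˡ x) ⟨
  x⁻¹ * x * y    ≡⟨ *-assoc x⁻¹ x y ⟩
  x⁻¹ * (x * y)  ≡⟨ cong (x⁻¹ *_) xy≡0 ⟩
  x⁻¹ * 0ℚ       ≡⟨ *-zeroʳ x⁻¹ ⟩
  0ℚ             ∎
  where
    open ≡-Reasoning
    instance _ = ≢-nonZero x≢0
    x⁻¹ : ℚ
    x⁻¹ = 1/ x

x-y≡0⇒x≡y : ∀ {x y} → x - y ≡ 0ℚ → x ≡ y
x-y≡0⇒x≡y {x} {y} x-y≡0 = trans (identity x y) (trans (cong (_+ y) x-y≡0) (+-identityˡ y))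
  where
    identity : ∀ x y → x ≡ (x - y) + y
    identity = solve 2 (λ x y → x := (x :- y) :+ y) refl

0≤x*y⇒0≤x : ∀ {x y} → 0ℚ ℚ.< y → 0ℚ ℚ.≤ x * y → 0ℚ ℚ.≤ x
0≤x*y⇒0≤x {x} {y} 0<y 0≤xy = *-cancelʳ-≤-pos y {{positive 0<y}} (subst (ℚ._≤ x * y) (sym (*-zeroˡ y)) 0≤xy)

convex-combination-pos : ∀ {t a b} → 0ℚ ℚ.≤ t → 0ℚ ℚ.≤ 1ℚ - t → 0ℚ ℚ.< a → 0ℚ ℚ.< b →
                         0ℚ ℚ.< (1ℚ - t) * a + t * b
convex-combination-pos {t} {a} {b} 0≤t 0≤1-t 0<a 0<b with <-cmp 0ℚ t
... | tri< 0<t _ _ = subst (ℚ._< (1ℚ - t) * a + t * b) (cong₂ _+_ (*-zeroˡ a) (*-zeroʳ t)) (+-mono-≤-< 0≤[1-t]a 0<tb)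
  where
    0≤[1-t]a : 0ℚ * a ℚ.≤ (1ℚ - t) * a
    0≤[1-t]a = *-monoʳ-≤-nonNeg a {{nonNegative (<⇒≤ 0<a)}} 0≤1-t
    0<tb : t * 0ℚ ℚ.< t * b
    0<tb = *-monoʳ-<-pos t {{positive 0<t}} 0<b
... | tri≈ _ refl _ = subst (0ℚ ℚ.<_) (t≡0-identity a b) 0<a
  where
    t≡0-identity : ∀ a b → a ≡ (1ℚ - 0ℚ) * a + 0ℚ * b
    t≡0-identity = solve 2 (λ a b → a := (con 1ℚ :- con 0ℚ) :* a :+ con 0ℚ :* b) refl
... | tri> _ _ t<0 = ⊥-elim (<-irrefl refl (<-≤-trans t<0 0≤t))

i/1≡0⇒i≡0 : ∀ {i} → i / 1 ≡ 0ℚ → i ≡ ℤ.0ℤ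
i/1≡0⇒i≡0 {i} i/1≡0 = trans (sym (↥-/ i 1)) (cong (λ x → ↥ x ℤ.* ℤ.gcd i (ℤ.+ 1)) i/1≡0)

lincomb≡0 : ∀ {x y z} a b → x ≡ a * y - b * z → y ≡ 0ℚ → z ≡ 0ℚ → x ≡ 0ℚ
lincomb≡0 a b x≡ay-bz refl refl = trans x≡ay-bz (cong₂ _-_ (*-zeroʳ a) (*-zeroʳ b))

0ₚ : Pt
0ₚ = (0ℚ , 0ℚ)

_+ₚ_ : Pt → Pt → Pt
(a , b) +ₚ (c , d) = (a + c , b + d)

_·ₚ_ : ℚ → Pt → Pt
t ·ₚ (a , b) = (t * a , t * b)

infixl 6 _+ₚ_
infixr 7 _·ₚ_

swap : Pt → Pt
swap (a , b) = (b , a)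

-ₚ≡0ₚ⇒≡ : ∀ {p q} → p -ₚ q ≡ 0ₚ → p ≡ q
-ₚ≡0ₚ⇒≡ eq = cong₂ _,_ (x-y≡0⇒x≡y (cong proj₁ eq)) (x-y≡0⇒x≡y (cong proj₂ eq))

-ₚ≡⇒≡+ₚ : ∀ {p q w} → p -ₚ q ≡ w → p ≡ q +ₚ w
-ₚ≡⇒≡+ₚ {p1 , p2} {q1 , q2} refl = cong₂ _,_ (identity p1 q1) (identity p2 q2)
  where
    identity : ∀ p q → p ≡ q + (p - q)
    identity = solve 2 (λ p q → p := q :+ (p :- q)) refl

+ₚ-cancelˡ : ∀ {p δ} → p +ₚ δ ≡ p → δ ≡ 0ₚ
+ₚ-cancelˡ {p1 , p2} {δ1 , δ2} eq = cong₂ _,_ (cancel (cong proj₁ eq)) (cancel (cong proj₂ eq))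
  where
    identity : ∀ p δ → δ ≡ (p + δ) - p
    identity = solve 2 (λ p δ → δ := (p :+ δ) :- p) refl
    cancel : ∀ {p δ} → p + δ ≡ p → δ ≡ 0ℚ
    cancel {p} {δ} p+δ≡p = trans (identity p δ) (trans (cong (_- p) p+δ≡p) (+-inverseʳ p))

nonzero-coordinate : ∀ {v} → v ≢ 0ₚ → proj₁ v ≢ 0ℚ ⊎ proj₂ v ≢ 0ℚ
nonzero-coordinate {v1 , v2} v≢0 with v1 ≟ℚ 0ℚ | v2 ≟ℚ 0ℚ
... | yes refl | yes refl  = ⊥-elim (v≢0 refl)
... | no v1≢0  | _         = inj₁ v1≢0
... | yes _    | no v2≢0   = inj₂ v2≢0

cross-self : ∀ v → cross v v ≡ 0ℚ
cross-self (a , b) = identity a b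
  where
    identity : ∀ a b → a * b - b * a ≡ 0ℚ
    identity = solve 2 (λ a b → a :* b :- b :* a := con 0ℚ) refl

cross-0ₚ : ∀ v → cross v 0ₚ ≡ 0ℚ
cross-0ₚ (a , b) = cong₂ _-_ (*-zeroʳ a) (*-zeroʳ b)

cross-antisym : ∀ v w → cross v w ≡ - cross w v
cross-antisym (v1 , v2) (w1 , w2) = identity v1 v2 w1 w2
  where
    identity : ∀ v1 v2 w1 w2 → v1 * w2 - v2 * w1 ≡ - (w1 * v2 - w2 * v1)
    identity = solve 4 (λ v1 v2 w1 w2 → v1 :* w2 :- v2 :* w1 := :- (w1 :* v2 :- w2 :* v1)) refl

cross≡0-sym : ∀ {v w} → cross v w ≡ 0ℚ → cross w v ≡ 0ℚ
cross≡0-sym {v} {w} vw≡0 = trans (cross-antisym w v) (cong -_ vw≡0)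

cross-·ₚ : ∀ v t w → cross v (t ·ₚ w) ≡ t * cross v w
cross-·ₚ (v1 , v2) t (w1 , w2) = identity v1 v2 t w1 w2
  where
    identity : ∀ v1 v2 t w1 w2 → v1 * (t * w2) - v2 * (t * w1) ≡ t * (v1 * w2 - v2 * w1)
    identity = solve 5 (λ v1 v2 t w1 w2 →
      v1 :* (t :* w2) :- v2 :* (t :* w1)
      := t :* (v1 :* w2 :- v2 :* w1)) refl

cross-sub : ∀ v p q r → cross v (p -ₚ r) - cross v (q -ₚ r) ≡ cross v (p -ₚ q)
cross-sub (v1 , v2) (p1 , p2) (q1 , q2) (r1 , r2) = identity v1 v2 p1 p2 q1 q2 r1 r2
  where
    identity : ∀ v1 v2 p1 p2 q1 q2 r1 r2 →
      (v1 * (p2 - r2) - v2 * (p1 - r1)) - (v1 * (q2 - r2) - v2 * (q1 - r1)) ≡ v1 * (p2 - q2) - v2 * (p1 - q1)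
    identity = solve 8 (λ v1 v2 p1 p2 q1 q2 r1 r2 →
      (v1 :* (p2 :- r2) :- v2 :* (p1 :- r1)) :- (v1 :* (q2 :- r2) :- v2 :* (q1 :- r1))
      := v1 :* (p2 :- q2) :- v2 :* (p1 :- q1)) refl

cross-+ₚ-sub : ∀ v p δ r → cross v ((p +ₚ δ) -ₚ r) ≡ cross v (p -ₚ r) + cross v δ
cross-+ₚ-sub (v1 , v2) (p1 , p2) (δ1 , δ2) (r1 , r2) = identity v1 v2 p1 p2 δ1 δ2 r1 r2
  where
    identity : ∀ v1 v2 p1 p2 δ1 δ2 r1 r2 →
      v1 * ((p2 + δ2) - r2) - v2 * ((p1 + δ1) - r1) ≡ (v1 * (p2 - r2) - v2 * (p1 - r1)) + (v1 * δ2 - v2 * δ1)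
    identity = solve 8 (λ v1 v2 p1 p2 δ1 δ2 r1 r2 →
      v1 :* ((p2 :+ δ2) :- r2) :- v2 :* ((p1 :+ δ1) :- r1)
      := (v1 :* (p2 :- r2) :- v2 :* (p1 :- r1)) :+ (v1 :* δ2 :- v2 :* δ1)) refl

cross-shift : ∀ v p δ r ε → cross v ((p +ₚ δ) -ₚ (r +ₚ ε)) ≡ cross v (p -ₚ r) + (cross v δ - cross v ε)
cross-shift (v1 , v2) (p1 , p2) (δ1 , δ2) (r1 , r2) (ε1 , ε2) = identity v1 v2 p1 p2 δ1 δ2 r1 r2 ε1 ε2
  where
    identity : ∀ v1 v2 p1 p2 δ1 δ2 r1 r2 ε1 ε2 →
      v1 * ((p2 + δ2) - (r2 + ε2)) - v2 * ((p1 + δ1) - (r1 + ε1))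
        ≡ (v1 * (p2 - r2) - v2 * (p1 - r1)) + ((v1 * δ2 - v2 * δ1) - (v1 * ε2 - v2 * ε1))
    identity = solve 10 (λ v1 v2 p1 p2 δ1 δ2 r1 r2 ε1 ε2 →
      v1 :* ((p2 :+ δ2) :- (r2 :+ ε2)) :- v2 :* ((p1 :+ δ1) :- (r1 :+ ε1))
      := (v1 :* (p2 :- r2) :- v2 :* (p1 :- r1)) :+ ((v1 :* δ2 :- v2 :* δ1) :- (v1 :* ε2 :- v2 :* ε1))) refl

cross-on-segment : ∀ v a b t r →
  cross v ((a +ₚ t ·ₚ (b -ₚ a)) -ₚ r) ≡ (1ℚ - t) * cross v (a -ₚ r) + t * cross v (b -ₚ r)
cross-on-segment (v1 , v2) (a1 , a2) (b1 , b2) t (r1 , r2) = identity v1 v2 a1 a2 b1 b2 t r1 r2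
  where
    identity : ∀ v1 v2 a1 a2 b1 b2 t r1 r2 →
      v1 * ((a2 + t * (b2 - a2)) - r2) - v2 * ((a1 + t * (b1 - a1)) - r1)
        ≡ (1ℚ - t) * (v1 * (a2 - r2) - v2 * (a1 - r1)) + t * (v1 * (b2 - r2) - v2 * (b1 - r1))
    identity = solve 9 (λ v1 v2 a1 a2 b1 b2 t r1 r2 →
      v1 :* ((a2 :+ t :* (b2 :- a2)) :- r2) :- v2 :* ((a1 :+ t :* (b1 :- a1)) :- r1)
      := (con 1ℚ :- t) :* (v1 :* (a2 :- r2) :- v2 :* (a1 :- r1)) :+ t :* (v1 :* (b2 :- r2) :- v2 :* (b1 :- r1))) refl

cross-independent⇒≡0ₚ : ∀ {u v w} → cross u v ≢ 0ℚ → cross u w ≡ 0ℚ → cross v w ≡ 0ℚ → w ≡ 0ₚ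
cross-independent⇒≡0ₚ {u1 , u2} {v1 , v2} {w1 , w2} uv≢0 uw≡0 vw≡0 = cong₂ _,_
    (x*y≡0⇒y≡0 uv≢0 (lincomb≡0 v1 u1 (cramer₁ u1 u2 v1 v2 w1 w2) uw≡0 vw≡0))
    (x*y≡0⇒y≡0 uv≢0 (lincomb≡0 v2 u2 (cramer₂ u1 u2 v1 v2 w1 w2) uw≡0 vw≡0))
  where
    cramer₁ : ∀ u1 u2 v1 v2 w1 w2 →
      (u1 * v2 - u2 * v1) * w1 ≡ v1 * (u1 * w2 - u2 * w1) - u1 * (v1 * w2 - v2 * w1)
    cramer₁ = solve 6 (λ u1 u2 v1 v2 w1 w2 →
      (u1 :* v2 :- u2 :* v1) :* w1
      := v1 :* (u1 :* w2 :- u2 :* w1) :- u1 :* (v1 :* w2 :- v2 :* w1)) refl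
    cramer₂ : ∀ u1 u2 v1 v2 w1 w2 →
      (u1 * v2 - u2 * v1) * w2 ≡ v2 * (u1 * w2 - u2 * w1) - u2 * (v1 * w2 - v2 * w1)
    cramer₂ = solve 6 (λ u1 u2 v1 v2 w1 w2 →
      (u1 :* v2 :- u2 :* v1) :* w2
      := v2 :* (u1 :* w2 :- u2 :* w1) :- u2 :* (v1 :* w2 :- v2 :* w1)) refl

cross≡0-trans : ∀ {m v w} → m ≢ 0ₚ → cross m v ≡ 0ℚ → cross m w ≡ 0ℚ → cross v w ≡ 0ℚ
cross≡0-trans {m1 , m2} {v1 , v2} {w1 , w2} m≢0 mv≡0 mw≡0 with nonzero-coordinate m≢0
... | inj₁ m1≢0 = x*y≡0⇒y≡0 m1≢0 (lincomb≡0 v1 w1 (identity₁ m1 m2 v1 v2 w1 w2) mw≡0 mv≡0)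
  where
    identity₁ : ∀ m1 m2 v1 v2 w1 w2 →
      m1 * (v1 * w2 - v2 * w1) ≡ v1 * (m1 * w2 - m2 * w1) - w1 * (m1 * v2 - m2 * v1)
    identity₁ = solve 6 (λ m1 m2 v1 v2 w1 w2 →
      m1 :* (v1 :* w2 :- v2 :* w1)
      := v1 :* (m1 :* w2 :- m2 :* w1) :- w1 :* (m1 :* v2 :- m2 :* v1)) refl
... | inj₂ m2≢0 = x*y≡0⇒y≡0 m2≢0 (lincomb≡0 v2 w2 (identity₂ m1 m2 v1 v2 w1 w2) mw≡0 mv≡0)
  where
    identity₂ : ∀ m1 m2 v1 v2 w1 w2 →
      m2 * (v1 * w2 - v2 * w1) ≡ v2 * (m1 * w2 - m2 * w1) - w2 * (m1 * v2 - m2 * v1)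
    identity₂ = solve 6 (λ m1 m2 v1 v2 w1 w2 →
      m2 :* (v1 :* w2 :- v2 :* w1)
      := v2 :* (m1 :* w2 :- m2 :* w1) :- w2 :* (m1 :* v2 :- m2 :* v1)) refl

cross-sub-self : ∀ v p → cross v (p -ₚ p) ≡ 0ℚ
cross-sub-self (v1 , v2) (p1 , p2) = identity v1 v2 p1 p2
  where
    identity : ∀ v1 v2 p1 p2 → v1 * (p2 - p2) - v2 * (p1 - p1) ≡ 0ℚ
    identity = solve 4 (λ v1 v2 p1 p2 → v1 :* (p2 :- p2) :- v2 :* (p1 :- p1) := con 0ℚ) refl

cross-sub-trans : ∀ v p q r → cross v (r -ₚ p) ≡ cross v (r -ₚ q) + cross v (q -ₚ p)
cross-sub-trans (v1 , v2) (p1 , p2) (q1 , q2) (r1 , r2) = identity v1 v2 p1 p2 q1 q2 r1 r2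
  where
    identity : ∀ v1 v2 p1 p2 q1 q2 r1 r2 →
      v1 * (r2 - p2) - v2 * (r1 - p1) ≡ (v1 * (r2 - q2) - v2 * (r1 - q1)) + (v1 * (q2 - p2) - v2 * (q1 - p1))
    identity = solve 8 (λ v1 v2 p1 p2 q1 q2 r1 r2 →
      v1 :* (r2 :- p2) :- v2 :* (r1 :- p1)
      := (v1 :* (r2 :- q2) :- v2 :* (r1 :- q1)) :+ (v1 :* (q2 :- p2) :- v2 :* (q1 :- p1))) refl

cross-sub-antisym : ∀ v p q → cross v (p -ₚ q) ≡ - cross v (q -ₚ p)
cross-sub-antisym (v1 , v2) (p1 , p2) (q1 , q2) = identity v1 v2 p1 p2 q1 q2
  where
    identity : ∀ v1 v2 p1 p2 q1 q2 → v1 * (p2 - q2) - v2 * (p1 - q1) ≡ - (v1 * (q2 - p2) - v2 * (q1 - p1))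
    identity = solve 6 (λ v1 v2 p1 p2 q1 q2 →
      v1 :* (p2 :- q2) :- v2 :* (p1 :- q1)
      := :- (v1 :* (q2 :- p2) :- v2 :* (q1 :- p1))) refl

private
  multiple-of-first≢0 : ∀ {u w} → proj₁ u ≢ 0ℚ → cross u w ≡ 0ℚ → Σ ℚ λ t → w ≡ t ·ₚ u
  multiple-of-first≢0 {u1 , u2} {w1 , w2} u1≢0 uw≡0 = t , cong₂ _,_ (x-y≡0⇒x≡y w1-tu1≡0) (x-y≡0⇒x≡y w2-tu2≡0)
    where
      instance _ = ≢-nonZero u1≢0
      t : ℚ
      t = w1 * 1/ u1
      identity₁ : ∀ w1 i u1 → w1 - (w1 * i) * u1 ≡ w1 * (1ℚ - i * u1)
      identity₁ = solve 3 (λ w1 i u1 → w1 :- (w1 :* i) :* u1 := w1 :* (con 1ℚ :- i :* u1)) refl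
      identity₂ : ∀ w1 w2 u1 u2 t → u1 * (w2 - t * u2) ≡ (u1 * w2 - u2 * w1) + u2 * (w1 - t * u1)
      identity₂ = solve 5 (λ w1 w2 u1 u2 t →
        u1 :* (w2 :- t :* u2)
        := (u1 :* w2 :- u2 :* w1) :+ u2 :* (w1 :- t :* u1)) refl
      w1-tu1≡0 : w1 - t * u1 ≡ 0ℚ
      w1-tu1≡0 = trans (identity₁ w1 (1/ u1) u1) (trans (cong (λ x → w1 * (1ℚ - x)) (*-inverseˡ u1)) (*-zeroʳ w1))
      w2-tu2≡0 : w2 - t * u2 ≡ 0ℚ
      w2-tu2≡0 = x*y≡0⇒y≡0 {y = w2 - t * u2} u1≢0 (begin
        u1 * (w2 - t * u2)                      ≡⟨ identity₂ w1 w2 u1 u2 t ⟩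
        (u1 * w2 - u2 * w1) + u2 * (w1 - t * u1) ≡⟨ cong₂ (λ x y → x + u2 * y) uw≡0 w1-tu1≡0 ⟩
        0ℚ + u2 * 0ℚ                              ≡⟨ cong (0ℚ +_) (*-zeroʳ u2) ⟩
        0ℚ                                        ∎)
        where open ≡-Reasoning

cross-swap≡0 : ∀ {u w} → cross u w ≡ 0ℚ → cross (swap u) (swap w) ≡ 0ℚ
cross-swap≡0 {u1 , u2} {w1 , w2} uw≡0 = trans (identity u1 u2 w1 w2) (cong (λ x → 0ℚ - x) uw≡0)
  where
    identity : ∀ u1 u2 w1 w2 → u2 * w1 - u1 * w2 ≡ 0ℚ - (u1 * w2 - u2 * w1)
    identity = solve 4 (λ u1 u2 w1 w2 → u2 :* w1 :- u1 :* w2 := con 0ℚ :- (u1 :* w2 :- u2 :* w1)) refl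

cross≡0⇒multiple : ∀ {u w} → u ≢ 0ₚ → cross u w ≡ 0ℚ → Σ ℚ λ t → w ≡ t ·ₚ u
cross≡0⇒multiple {u1 , u2} {w1 , w2} u≢0 uw≡0 with nonzero-coordinate {u1 , u2} u≢0
... | inj₁ u1≢0 = multiple-of-first≢0 {u1 , u2} {w1 , w2} u1≢0 uw≡0
... | inj₂ u2≢0 = unswap (multiple-of-first≢0 {u2 , u1} {w2 , w1} u2≢0 (cross-swap≡0 {u1 , u2} {w1 , w2} uw≡0))
  where
    unswap : (Σ ℚ λ t → (w2 , w1) ≡ t ·ₚ (u2 , u1)) → Σ ℚ λ t → (w1 , w2) ≡ t ·ₚ (u1 , u2)
    unswap (t , eq) = t , cong swap eq

-- Boards and the rider's lines

module BoardGeometry (B : Board) where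
  open Board B
  open Cyclic k using (next-prev; next-injective; next≢id; next²≢id; next≢prev)

  edgeVec : Fin n → Pt
  edgeVec e = corner (next e) -ₚ corner e

  edgeForm-relative : ∀ e {p q} → OnEdgeLine e q → edgeForm e p ≡ cross (edgeVec e) (p -ₚ q)
  edgeForm-relative e {p} {q} q-on-e = begin
    edgeForm e p                 ≡⟨ +-identityʳ (edgeForm e p) ⟨
    edgeForm e p - 0ℚ            ≡⟨ cong (λ x → edgeForm e p - x) q-on-e ⟨
    edgeForm e p - edgeForm e q  ≡⟨ cross-sub (edgeVec e) p q (corner e) ⟩
    cross (edgeVec e) (p -ₚ q)   ∎
    where open ≡-Reasoning

  onEdgeLine-sub : ∀ e {p q} → OnEdgeLine e p → OnEdgeLine e q → cross (edgeVec e) (p -ₚ q) ≡ 0ℚ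
  onEdgeLine-sub e {p} {q} p-on-e q-on-e = trans (sym (edgeForm-relative e {p} {q} q-on-e)) p-on-e

  corner-onEdgeLine : ∀ e → OnEdgeLine e (corner e)
  corner-onEdgeLine e = cross-sub-self (edgeVec e) (corner e)

  next-onEdgeLine : ∀ e → OnEdgeLine e (corner (next e))
  next-onEdgeLine e = cross-self (edgeVec e)

  corner-onPrevEdgeLine : ∀ e → OnEdgeLine (prev e) (corner e)
  corner-onPrevEdgeLine e = subst (λ j → OnEdgeLine (prev e) (corner j)) (next-prev e) (next-onEdgeLine (prev e))

  corner-inBoard : ∀ i → InBoard (corner i)
  corner-inBoard i e with i ≟ e | i ≟ next e
  ... | yes refl | _        = ≤-reflexive (sym (corner-onEdgeLine e))
  ... | no _     | yes refl = ≤-reflexive (sym (next-onEdgeLine e))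
  ... | no i≢e   | no i≢e′  = <⇒≤ (strictlyConvex e i i≢e i≢e′)

  onEdgeLine-corner : ∀ {e j} → OnEdgeLine e (corner j) → j ≡ e ⊎ j ≡ next e
  onEdgeLine-corner {e} {j} j-on-e with j ≟ e | j ≟ next e
  ... | yes j≡e | _         = inj₁ j≡e
  ... | no _    | yes j≡e′  = inj₂ j≡e′
  ... | no j≢e  | no j≢e′   = ⊥-elim (<-irrefl (sym j-on-e) (strictlyConvex e j j≢e j≢e′))

  edgeVec≢0ₚ : ∀ e → edgeVec e ≢ 0ₚ
  edgeVec≢0ₚ e u≡0 = <-irrefl (sym on-e) (strictlyConvex e j (λ j≡e → next²≢id e j≡e) (next≢id (next e)))
    where
      j = next (next e)
      on-e : OnEdgeLine e (corner j)
      on-e = trans (cong (λ v → cross v (corner j -ₚ corner e)) u≡0)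
                   (cross≡0-sym {corner j -ₚ corner e} {0ₚ} (cross-0ₚ (corner j -ₚ corner e)))

  adjacent-edges-independent : ∀ i → cross (edgeVec i) (edgeVec (prev i)) ≢ 0ℚ
  adjacent-edges-independent i cross≡0 = <-irrefl (sym on-prev)
    (strictlyConvex (prev i) (next i) (next≢prev i) (λ eq → next≢id i (trans eq (next-prev i))))
    where
      on-prev : OnEdgeLine (prev i) (corner (next i))
      on-prev = trans (edgeForm-relative (prev i) {corner (next i)} {corner i} (corner-onPrevEdgeLine i))
                      (cross≡0-sym {edgeVec i} {edgeVec (prev i)} cross≡0)

  edgeLines-meet-once : ∀ {e f p q} → cross (edgeVec e) (edgeVec f) ≢ 0ℚ →
                        OnEdgeLine e p → OnEdgeLine f p → OnEdgeLine e q → OnEdgeLine f q → p ≡ q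
  edgeLines-meet-once {e} {f} {p} {q} ef≢0 p-on-e p-on-f q-on-e q-on-f = -ₚ≡0ₚ⇒≡ {p} {q}
    (cross-independent⇒≡0ₚ {edgeVec e} {edgeVec f} {p -ₚ q} ef≢0
      (onEdgeLine-sub e {p} {q} p-on-e q-on-e) (onEdgeLine-sub f {p} {q} p-on-f q-on-f))

  OnEdge : Fin n → Pt → Set
  OnEdge e p = Σ ℚ λ t → 0ℚ ℚ.≤ t × 0ℚ ℚ.≤ 1ℚ - t ×
    (∀ g → edgeForm g p ≡ (1ℚ - t) * edgeForm g (corner e) + t * edgeForm g (corner (next e)))

  inBoard∩edgeLine⇒onEdge : ∀ {e p} → InBoard p → OnEdgeLine e p → OnEdge e p
  inBoard∩edgeLine⇒onEdge {e} {p} p∈B p-on-e = along (cross≡0⇒multiple {edgeVec e} {p -ₚ corner e} (edgeVec≢0ₚ e) p-on-e)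
    where
      along : (Σ ℚ λ t → p -ₚ corner e ≡ t ·ₚ edgeVec e) → OnEdge e p
      along (t , p-e≡tu) = t , 0≤t , 0≤1-t , edgeForm-p
        where
          edgeForm-p : ∀ g → edgeForm g p ≡ (1ℚ - t) * edgeForm g (corner e) + t * edgeForm g (corner (next e))
          edgeForm-p g = trans (cong (edgeForm g) (-ₚ≡⇒≡+ₚ {p} {corner e} p-e≡tu))
                               (cross-on-segment (edgeVec g) (corner e) (corner (next e)) t (corner g))
          0≤t : 0ℚ ℚ.≤ t
          0≤t = 0≤x*y⇒0≤x (strictlyConvex (prev e) (next e) (next≢prev e) (λ eq → next≢id e (trans eq (next-prev e))))
                  (subst (0ℚ ℚ.≤_) edgeForm-prev-p (p∈B (prev e)))
            where
              b : ℚ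
              b = edgeForm (prev e) (corner (next e))
              drop-zero : ∀ t b → (1ℚ - t) * 0ℚ + t * b ≡ t * b
              drop-zero = solve 2 (λ t b → (con 1ℚ :- t) :* con 0ℚ :+ t :* b := t :* b) refl
              edgeForm-prev-p : edgeForm (prev e) p ≡ t * b
              edgeForm-prev-p = begin
                edgeForm (prev e) p                              ≡⟨ edgeForm-p (prev e) ⟩
                (1ℚ - t) * edgeForm (prev e) (corner e) + t * b
                  ≡⟨ cong (λ x → (1ℚ - t) * x + t * b) (corner-onPrevEdgeLine e) ⟩
                (1ℚ - t) * 0ℚ + t * b                            ≡⟨ drop-zero t b ⟩
                t * b                                            ∎
                where open ≡-Reasoning
          0≤1-t : 0ℚ ℚ.≤ 1ℚ - t
          0≤1-t = 0≤x*y⇒0≤x (strictlyConvex (next e) e (λ eq → next≢id e (sym eq)) (λ eq → next²≢id e (sym eq)))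
                    (subst (0ℚ ℚ.≤_) edgeForm-next-p (p∈B (next e)))
            where
              a : ℚ
              a = edgeForm (next e) (corner e)
              drop-zero : ∀ t a → (1ℚ - t) * a + t * 0ℚ ≡ (1ℚ - t) * a
              drop-zero = solve 2 (λ t a → (con 1ℚ :- t) :* a :+ t :* con 0ℚ := (con 1ℚ :- t) :* a) refl
              edgeForm-next-p : edgeForm (next e) p ≡ (1ℚ - t) * a
              edgeForm-next-p = begin
                edgeForm (next e) p                                     ≡⟨ edgeForm-p (next e) ⟩
                (1ℚ - t) * a + t * edgeForm (next e) (corner (next e))
                  ≡⟨ cong (λ x → (1ℚ - t) * a + t * x) (corner-onEdgeLine (next e)) ⟩
                (1ℚ - t) * a + t * 0ℚ                                   ≡⟨ drop-zero t a ⟩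
                (1ℚ - t) * a                                            ∎
                where open ≡-Reasoning

  onEdge-edgeForm-pos : ∀ {e p} → OnEdge e p → ∀ f →
                        0ℚ ℚ.< edgeForm f (corner e) → 0ℚ ℚ.< edgeForm f (corner (next e)) → 0ℚ ℚ.< edgeForm f p
  onEdge-edgeForm-pos {e} {p} (t , 0≤t , 0≤1-t , edgeForm-p) f 0<a 0<b = subst (0ℚ ℚ.<_) (sym (edgeForm-p f))
    (convex-combination-pos {t} {edgeForm f (corner e)} {edgeForm f (corner (next e))} 0≤t 0≤1-t 0<a 0<b)

  crossingEdgeLines⇒corner : ∀ {e f p} → InBoard p → OnEdgeLine e p → OnEdgeLine f p →
                             cross (edgeVec e) (edgeVec f) ≢ 0ℚ → Σ (Fin n) λ i → p ≡ corner i
  crossingEdgeLines⇒corner {e} {f} {p} p∈B p-on-e p-on-f ef≢0 with f ≟ e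
  ... | yes refl = ⊥-elim (ef≢0 (cross-self (edgeVec e)))
  ... | no f≢e with e ≟ next f
  ...   | yes refl = e , edgeLines-meet-once {e} {f} {p} {corner e} ef≢0 p-on-e p-on-f (corner-onEdgeLine e) (next-onEdgeLine f)
  ...   | no e≢f′ with f ≟ next e
  ...     | yes refl = f , edgeLines-meet-once {e} {f} {p} {corner f} ef≢0 p-on-e p-on-f (next-onEdgeLine e) (corner-onEdgeLine f)
  ...     | no f≢e′ = ⊥-elim (<-irrefl (sym p-on-f)
                          (onEdge-edgeForm-pos {e} {p} (inBoard∩edgeLine⇒onEdge {e} {p} p∈B p-on-e) f
                          (strictlyConvex f e (λ eq → f≢e (sym eq)) e≢f′)
                          (strictlyConvex f (next e) (λ eq → f≢e′ (sym eq)) (λ eq → f≢e (sym (next-injective {e} {f} eq))))))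

module RiderGeometry (B : Board) (m : Move) where
  open Board B
  open Move m
  open BoardGeometry B
  open Cyclic k using (next-prev)

  vec≢0ₚ : vec ≢ 0ₚ
  vec≢0ₚ vec≡0 = 0≢1+n (trans (sym gcd[0,0]≡0)
    (subst₂ (λ x y → gcd ℤ.∣ x ∣ ℤ.∣ y ∣ ≡ 1)
            (i/1≡0⇒i≡0 {c} (cong proj₁ vec≡0)) (i/1≡0⇒i≡0 {d} (cong proj₂ vec≡0)) coprime))

  Parallel? : ∀ v → Dec (Parallel v)
  Parallel? v = cross vec v ≟ℚ 0ℚ

  _≟ₚ_ : (p q : Pt) → Dec (p ≡ q)
  _≟ₚ_ = ≡-dec _≟ℚ_ _≟ℚ_

  parallel-refl : ∀ p → Parallel (p -ₚ p)
  parallel-refl p = cross-sub-self vec p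

  parallel-sym : ∀ {p q} → Parallel (q -ₚ p) → Parallel (p -ₚ q)
  parallel-sym {p} {q} q∥p = trans (cross-sub-antisym vec p q) (cong -_ q∥p)

  parallel-trans : ∀ {p q r} → Parallel (q -ₚ p) → Parallel (r -ₚ q) → Parallel (r -ₚ p)
  parallel-trans {p} {q} {r} q∥p r∥q = trans (cross-sub-trans vec p q r) (cong₂ _+_ r∥q q∥p)

  private
    moveForm-cross : ∀ c d v1 v2 → d * v1 - c * v2 ≡ 0ℚ - (c * v2 - d * v1)
    moveForm-cross = solve 4 (λ c d v1 v2 → d :* v1 :- c :* v2 := con 0ℚ :- (c :* v2 :- d :* v1)) refl
    cross-moveForm : ∀ c d v1 v2 → c * v2 - d * v1 ≡ 0ℚ - (d * v1 - c * v2)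
    cross-moveForm = solve 4 (λ c d v1 v2 → c :* v2 :- d :* v1 := con 0ℚ :- (d :* v1 :- c :* v2)) refl

  moveRel⇒parallel : ∀ {p q} → MoveRel p q → Parallel (q -ₚ p)
  moveRel⇒parallel {p} {q} rel =
    trans (cross-moveForm (c / 1) (d / 1) (proj₁ (q -ₚ p)) (proj₂ (q -ₚ p))) (cong (λ x → 0ℚ - x) rel)

  parallel⇒moveRel : ∀ {p q} → Parallel (q -ₚ p) → MoveRel p q
  parallel⇒moveRel {p} {q} q∥p =
    trans (moveForm-cross (c / 1) (d / 1) (proj₁ (q -ₚ p)) (proj₂ (q -ₚ p))) (cong (λ x → 0ℚ - x) q∥p)

  parallel∧nonParallel⇒independent : ∀ {v w} → v ≢ 0ₚ → Parallel v → ¬ Parallel w → cross v w ≢ 0ℚ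
  parallel∧nonParallel⇒independent {v} {w} v≢0 v∥ w∦ vw≡0 =
    w∦ (cross≡0-trans {v} {vec} {w} v≢0 (cross≡0-sym {vec} {v} v∥) vw≡0)

  parallelEdgeLine-closed : ∀ {e p r} → Parallel (edgeVec e) → Parallel (p -ₚ r) → OnEdgeLine e r → OnEdgeLine e p
  parallelEdgeLine-closed {e} {p} {r} e∥ p∥r r-on-e =
    trans (edgeForm-relative e {p} {r} r-on-e) (cross≡0-trans {vec} {edgeVec e} {p -ₚ r} vec≢0ₚ e∥ p∥r)

  module _ {a p} (p∈B : InBoard p) (p-on-a : OnEdgeLine a p) (a∦ : ¬ Parallel (edgeVec a)) where

    alignedWithParallelEdge⇒corner : ∀ {e r} → Parallel (edgeVec e) → OnEdgeLine e r → Parallel (p -ₚ r) → IsCorner B m p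
    alignedWithParallelEdge⇒corner {e} {r} e∥ r-on-e p∥r =
      crossingEdgeLines⇒corner {e} {a} {p} p∈B (parallelEdgeLine-closed {e} {p} {r} e∥ p∥r r-on-e) p-on-a
        (parallel∧nonParallel⇒independent {edgeVec e} {edgeVec a} (edgeVec≢0ₚ e) e∥ a∦)

    alignedWithCorner⇒cornerOrAntipode : ∀ i → Parallel (p -ₚ corner i) → IsCornerOrAntipode B m p
    alignedWithCorner⇒cornerOrAntipode i p∥i with p ≟ₚ corner i
    ... | yes p≡i = inj₁ (i , p≡i)
    ... | no p≢i with Parallel? (edgeVec i)
    ...   | yes i∥ = inj₁ (alignedWithParallelEdge⇒corner {i} {corner i} i∥ (corner-onEdgeLine i) p∥i)
    ...   | no i∦ with Parallel? (corner i -ₚ corner (prev i))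
    ...     | yes prev∥ = inj₁ (alignedWithParallelEdge⇒corner {prev i} {corner i}
                             (subst (λ j → Parallel (corner j -ₚ corner (prev i))) (sym (next-prev i)) prev∥)
                             (corner-onPrevEdgeLine i) p∥i)
    ...     | no prev∦ = inj₂ (i , inj₂ (inj₂ (i∦ , prev∦ , (p∈B , a , p-on-a) , p≢i , p∥i)))

-- Vertices of the inside-out polytope

_onlyIf_ : ∀ {P : Set} → Pt → Dec P → Pt
v onlyIf yes _ = v
v onlyIf no _  = 0ₚ

onlyIf-yes : ∀ {P : Set} (d : Dec P) v → P → v onlyIf d ≡ v
onlyIf-yes (yes _)  v _ = refl
onlyIf-yes (no ¬p)  v p = ⊥-elim (¬p p)

onlyIf-no : ∀ {P : Set} (d : Dec P) v → ¬ P → v onlyIf d ≡ 0ₚ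
onlyIf-no (yes p) v ¬p = ⊥-elim (¬p p)
onlyIf-no (no _)  v _  = refl

onlyIf-cross≡0 : ∀ {P : Set} w v (d : Dec P) → (P → cross w v ≡ 0ℚ) → cross w (v onlyIf d) ≡ 0ℚ
onlyIf-cross≡0 w v (yes p) wv≡0 = wv≡0 p
onlyIf-cross≡0 w v (no _)  _    = cross-0ₚ w

module VertexRigidity (B : Board) (m : Move) {q} (z : Config B m q) (z-vertex : IsVertex B m q z) where
  open Board B
  open Move m
  open BoardGeometry B
  open RiderGeometry B m

  z∈B : ∀ a → InBoard (z a)
  z∈B = proj₁ z-vertex

  M : List (Fin q × Fin q)
  M = proj₁ (proj₂ z-vertex)

  F : List (Fin q × Fin n)
  F = proj₁ (proj₂ (proj₂ z-vertex))

  z-satisfies : Satisfies B m M F z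
  z-satisfies = proj₁ (proj₂ (proj₂ (proj₂ z-vertex)))

  z-unique : ∀ w → Satisfies B m M F w → ∀ a → w a ≡ z a
  z-unique = proj₂ (proj₂ (proj₂ (proj₂ z-vertex)))

  moveRel∈M : ∀ {x} → x ∈ M → MoveRel (z (proj₁ x)) (z (proj₂ x))
  moveRel∈M = All.lookup (proj₁ z-satisfies)

  onEdgeLine∈F : ∀ {x} → x ∈ F → OnEdgeLine (proj₂ x) (z (proj₁ x))
  onEdgeLine∈F = All.lookup (proj₂ z-satisfies)

  rigid : (δ : Fin q → Pt) →
          (∀ {x} → x ∈ M → cross vec (δ (proj₂ x)) ≡ cross vec (δ (proj₁ x))) →
          (∀ {x} → x ∈ F → cross (edgeVec (proj₂ x)) (δ (proj₁ x)) ≡ 0ℚ) →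
          ∀ a → δ a ≡ 0ₚ
  rigid δ δ-moves δ-facets a = +ₚ-cancelˡ {z a} {δ a} (z-unique w w-satisfies a)
    where
      w : Config B m q
      w b = z b +ₚ δ b
      w-move : ∀ {x} → x ∈ M → MoveRel (w (proj₁ x)) (w (proj₂ x))
      w-move {i , j} x∈M = parallel⇒moveRel {w i} {w j} (begin
        cross vec (w j -ₚ w i)                                          ≡⟨ cross-shift vec (z j) (δ j) (z i) (δ i) ⟩
        cross vec (z j -ₚ z i) + (cross vec (δ j) - cross vec (δ i))
          ≡⟨ cong₂ (λ x y → x + (y - cross vec (δ i))) (moveRel⇒parallel {z i} {z j} (moveRel∈M x∈M)) (δ-moves x∈M) ⟩
        0ℚ + (cross vec (δ i) - cross vec (δ i))                        ≡⟨ +-identityˡ _ ⟩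
        cross vec (δ i) - cross vec (δ i)                               ≡⟨ +-inverseʳ (cross vec (δ i)) ⟩
        0ℚ                                                              ∎)
        where open ≡-Reasoning
      w-facet : ∀ {x} → x ∈ F → OnEdgeLine (proj₂ x) (w (proj₁ x))
      w-facet {b , e} x∈F =
        trans (cross-+ₚ-sub (edgeVec e) (z b) (δ b) (corner e)) (cong₂ _+_ (onEdgeLine∈F x∈F) (δ-facets x∈F))
      w-satisfies : Satisfies B m M F w
      w-satisfies = All.tabulate w-move , All.tabulate w-facet

  ¬allFacetsParallel : ∀ a → ¬ (∀ {e} → (a , e) ∈ F → Parallel (edgeVec e))
  ¬allFacetsParallel a all∥ = vec≢0ₚ (trans (sym (onlyIf-yes (a ≟ a) vec refl)) (rigid δ δ-moves δ-facets a))
    where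
      δ : Fin q → Pt
      δ b = vec onlyIf (b ≟ a)
      δ∥ : ∀ b → Parallel (δ b)
      δ∥ b = onlyIf-cross≡0 vec vec (b ≟ a) (λ _ → cross-self vec)
      δ-moves : ∀ {x} → x ∈ M → cross vec (δ (proj₂ x)) ≡ cross vec (δ (proj₁ x))
      δ-moves {i , j} _ = trans (δ∥ j) (sym (δ∥ i))
      δ-facets : ∀ {x} → x ∈ F → cross (edgeVec (proj₂ x)) (δ (proj₁ x)) ≡ 0ℚ
      δ-facets {b , e} x∈F = onlyIf-cross≡0 (edgeVec e) vec (b ≟ a)
        (λ b≡a → cross≡0-sym {vec} {edgeVec e} (all∥ (subst (λ c → (c , e) ∈ F) b≡a x∈F)))

  nonParallelFacet : ∀ a → Σ (Fin n) λ e → (a , e) ∈ F × ¬ Parallel (edgeVec e)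
  nonParallelFacet a with Any.any? (λ x → (proj₁ x ≟ a) ×-dec ¬? (Parallel? (edgeVec (proj₂ x)))) F
  ... | yes found with find found
  ...   | (_ , e) , x∈F , refl , e∦ = e , x∈F , e∦
  nonParallelFacet a | no none = ⊥-elim (¬allFacetsParallel a (λ {e} e∈F →
    decidable-stable (Parallel? (edgeVec e)) (λ e∦ → none (lose e∈F (refl , e∦)))))

  facetEdge : Fin q → Fin n
  facetEdge b = proj₁ (nonParallelFacet b)

  facetEdge∈F : ∀ b → (b , facetEdge b) ∈ F
  facetEdge∈F b = proj₁ (proj₂ (nonParallelFacet b))

  facetEdge∦ : ∀ b → ¬ Parallel (edgeVec (facetEdge b))
  facetEdge∦ b = proj₂ (proj₂ (nonParallelFacet b))

  facetDir : Fin q → Pt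
  facetDir b = (1/ cross vec (edgeVec (facetEdge b))) {{≢-nonZero (facetEdge∦ b)}} ·ₚ edgeVec (facetEdge b)

  facetDir-normalized : ∀ b → cross vec (facetDir b) ≡ 1ℚ
  facetDir-normalized b = trans (cross-·ₚ vec (1/ κ) (edgeVec (facetEdge b))) (*-inverseˡ κ)
    where
      κ : ℚ
      κ = cross vec (edgeVec (facetEdge b))
      instance _ = ≢-nonZero (facetEdge∦ b)

  facetDir-cross≡0 : ∀ b f → cross (edgeVec f) (edgeVec (facetEdge b)) ≡ 0ℚ → cross (edgeVec f) (facetDir b) ≡ 0ℚ
  facetDir-cross≡0 b f fe≡0 =
    trans (cross-·ₚ (edgeVec f) κ⁻¹ (edgeVec (facetEdge b))) (trans (cong (κ⁻¹ *_) fe≡0) (*-zeroʳ κ⁻¹))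
    where
      instance _ = ≢-nonZero (facetEdge∦ b)
      κ⁻¹ : ℚ
      κ⁻¹ = 1/ cross vec (edgeVec (facetEdge b))

  -- Slide the pieces aligned with z_a along their transverse facets, each with unit component across m.
  ¬uncrossedClass : ∀ a →
    ¬ (∀ b → Parallel (z b -ₚ z a) → ∀ {f} → (b , f) ∈ F → cross (edgeVec f) (edgeVec (facetEdge b)) ≡ 0ℚ)
  ¬uncrossedClass a uncrossed = 1≢0 (begin
      1ℚ               ≡⟨ inClass-cross a (parallel-refl (z a)) ⟨
      cross vec (δ a)  ≡⟨ cong (cross vec) (rigid δ δ-moves δ-facets a) ⟩
      cross vec 0ₚ     ≡⟨ cross-0ₚ vec ⟩
      0ℚ               ∎)
    where
      open ≡-Reasoning
      InClass : Fin q → Set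
      InClass b = Parallel (z b -ₚ z a)
      δ : Fin q → Pt
      δ b = facetDir b onlyIf Parallel? (z b -ₚ z a)
      inClass-cross : ∀ b → InClass b → cross vec (δ b) ≡ 1ℚ
      inClass-cross b b∥a = trans (cong (cross vec) (onlyIf-yes (Parallel? (z b -ₚ z a)) (facetDir b) b∥a)) (facetDir-normalized b)
      outside-cross : ∀ b → ¬ InClass b → cross vec (δ b) ≡ 0ℚ
      outside-cross b b∦a = trans (cong (cross vec) (onlyIf-no (Parallel? (z b -ₚ z a)) (facetDir b) b∦a)) (cross-0ₚ vec)
      δ-moves : ∀ {x} → x ∈ M → cross vec (δ (proj₂ x)) ≡ cross vec (δ (proj₁ x))
      δ-moves {i , j} x∈M = agree (Parallel? (z i -ₚ z a)) (Parallel? (z j -ₚ z a))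
        where
          j∥i : Parallel (z j -ₚ z i)
          j∥i = moveRel⇒parallel {z i} {z j} (moveRel∈M x∈M)
          agree : Dec (InClass i) → Dec (InClass j) → cross vec (δ j) ≡ cross vec (δ i)
          agree (yes i∥a) (yes j∥a) = trans (inClass-cross j j∥a) (sym (inClass-cross i i∥a))
          agree (no i∦a)  (no j∦a)  = trans (outside-cross j j∦a) (sym (outside-cross i i∦a))
          agree (yes i∥a) (no j∦a)  = ⊥-elim (j∦a (parallel-trans {z a} {z i} {z j} i∥a j∥i))
          agree (no i∦a)  (yes j∥a) = ⊥-elim (i∦a (parallel-trans {z a} {z j} {z i} j∥a (parallel-sym {z i} {z j} j∥i)))
      δ-facets : ∀ {x} → x ∈ F → cross (edgeVec (proj₂ x)) (δ (proj₁ x)) ≡ 0ℚ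
      δ-facets {b , f} f∈F = onlyIf-cross≡0 (edgeVec f) (facetDir b) (Parallel? (z b -ₚ z a))
        (λ b∥a → facetDir-cross≡0 b f (uncrossed b b∥a f∈F))

  Crossing : Fin q → Set
  Crossing b = Any (λ x → proj₁ x ≡ b ×
                 Any (λ y → proj₁ y ≡ b × cross (edgeVec (proj₂ x)) (edgeVec (proj₂ y)) ≢ 0ℚ) F) F

  crossing? : ∀ b → Dec (Crossing b)
  crossing? b = Any.any? (λ x → (proj₁ x ≟ b) ×-dec
                  Any.any? (λ y → (proj₁ y ≟ b) ×-dec ¬? (cross (edgeVec (proj₂ x)) (edgeVec (proj₂ y)) ≟ℚ 0ℚ)) F) F

  crossing⇒corner : ∀ {b} → Crossing b → IsCorner B m (z b)
  crossing⇒corner crossing with find crossing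
  ... | (b , e) , e∈F , refl , crossing′ with find crossing′
  ...   | (_ , f) , f∈F , refl , ef≢0 =
    crossingEdgeLines⇒corner {e} {f} {z b} (z∈B b) (onEdgeLine∈F e∈F) (onEdgeLine∈F f∈F) ef≢0

  alignedWithCorner : ∀ a → Σ (Fin q) λ b → Parallel (z b -ₚ z a) × IsCorner B m (z b)
  alignedWithCorner a with Any.any? (λ b → Parallel? (z b -ₚ z a) ×-dec crossing? b) (allFin q)
  ... | yes found with find found
  ...   | b , _ , b∥a , crossing = b , b∥a , crossing⇒corner crossing
  alignedWithCorner a | no none = ⊥-elim (¬uncrossedClass a (λ b b∥a {f} f∈F →
    decidable-stable (cross (edgeVec f) (edgeVec (facetEdge b)) ≟ℚ 0ℚ)
      (λ fe≢0 → none (lose (∈-allFin b) (b∥a , lose f∈F (refl , lose (facetEdge∈F b) (refl , fe≢0)))))))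

  piece-cornerOrAntipode : ∀ a → IsCornerOrAntipode B m (z a)
  piece-cornerOrAntipode a with nonParallelFacet a | alignedWithCorner a
  ... | e , e∈F , e∦ | b , b∥a , i , zb≡i =
    alignedWithCorner⇒cornerOrAntipode {e} {z a} (z∈B a) (onEdgeLine∈F e∈F) e∦ i
      (parallel-sym {z a} {corner i} (subst (λ p → Parallel (p -ₚ z a)) zb≡i b∥a))

singlePiece-corner : ∀ B m (z : Config B m 1) → IsVertex B m 1 z → ∀ a → IsCorner B m (z a)
singlePiece-corner B m z z-vertex zero with VertexRigidity.alignedWithCorner B m z z-vertex zero
... | zero , _ , z-corner = z-corner

module VertexConstructions (B : Board) (m : Move) where
  open Board B
  open Move m
  open BoardGeometry B
  open RiderGeometry B m
  open Cyclic k using (next-prev; next-injective)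

  cornerFacets : ∀ {q r} → (Fin r → Fin q) → Fin n → List (Fin q × Fin n)
  cornerFacets {r = r} σ i = map (λ b → (σ b , i)) (allFin r) ++ map (λ b → (σ b , prev i)) (allFin r)

  cornerFacets-satisfied : ∀ {q r} (σ : Fin r → Fin q) i {w : Config B m q} →
                           (∀ b → w (σ b) ≡ corner i) → Satisfies B m [] (cornerFacets σ i) w
  cornerFacets-satisfied {r = r} σ i {w} w∘σ≡i = All.[] , All.++⁺
    (All.map⁺ (All.universal (λ b → subst (OnEdgeLine i) (sym (w∘σ≡i b)) (corner-onEdgeLine i)) (allFin r)))
    (All.map⁺ (All.universal (λ b → subst (OnEdgeLine (prev i)) (sym (w∘σ≡i b)) (corner-onPrevEdgeLine i)) (allFin r)))

  cornerFacets-force : ∀ {q r} (σ : Fin r → Fin q) i {w : Config B m q} →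
                       Satisfies B m [] (cornerFacets σ i) w → ∀ b → w (σ b) ≡ corner i
  cornerFacets-force {r = r} σ i {w} (_ , w-on) b =
    edgeLines-meet-once {i} {prev i} {w (σ b)} {corner i} (adjacent-edges-independent i)
      (All.lookup w-on (∈-++⁺ˡ (∈-map⁺ (λ b → (σ b , i)) (∈-allFin b))))
      (All.lookup w-on (∈-++⁺ʳ (map (λ b → (σ b , i)) (allFin r)) (∈-map⁺ (λ b → (σ b , prev i)) (∈-allFin b))))
      (corner-onEdgeLine i) (corner-onPrevEdgeLine i)

  corner-vertex : ∀ q i → IsVertex B m q (λ _ → corner i)
  corner-vertex q i = (λ _ → corner-inBoard i) , [] , cornerFacets id i ,
                      cornerFacets-satisfied id i (λ _ → refl) , λ w w-sat → cornerFacets-force id i w-sat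

  aligned-edgeLine-nonParallel : ∀ {i e w} → ¬ Parallel (edgeVec i) → ¬ Parallel (corner i -ₚ corner (prev i)) →
                                 OnEdgeLine e w → Parallel (w -ₚ corner i) → ¬ Parallel (edgeVec e)
  aligned-edgeLine-nonParallel {i} {e} {w} i∦ prev∦ w-on-e w∥i e∥ = at-end-of-e (onEdgeLine-corner {e} {i} i-on-e)
    where
      i-on-e : OnEdgeLine e (corner i)
      i-on-e = parallelEdgeLine-closed {e} {corner i} {w} e∥ (parallel-sym {corner i} {w} w∥i) w-on-e
      at-end-of-e : i ≡ e ⊎ i ≡ next e → ⊥
      at-end-of-e (inj₁ refl) = i∦ e∥
      at-end-of-e (inj₂ i≡e′) = prev∦ (subst (λ j → Parallel (corner j -ₚ corner (prev i))) (next-prev i)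
                                  (subst (λ f → Parallel (edgeVec f)) e≡prev e∥))
        where
          e≡prev : e ≡ prev i
          e≡prev = next-injective {e} {prev i} (trans (sym i≡e′) (sym (next-prev i)))

  edgeLine∩parallelLine-unique : ∀ {e p p′} → ¬ Parallel (edgeVec e) → OnEdgeLine e p → OnEdgeLine e p′ →
                                 Parallel (p′ -ₚ p) → p′ ≡ p
  edgeLine∩parallelLine-unique {e} {p} {p′} e∦ p-on-e p′-on-e p′∥p = -ₚ≡0ₚ⇒≡ {p′} {p}
    (cross-independent⇒≡0ₚ {edgeVec e} {vec} {p′ -ₚ p} (λ e×vec≡0 → e∦ (cross≡0-sym {edgeVec e} {vec} e×vec≡0))
      (onEdgeLine-sub e {p′} {p} p′-on-e p-on-e) p′∥p)

  antipode-vertex : ∀ {q i e w} → ¬ Parallel (edgeVec i) → ¬ Parallel (corner i -ₚ corner (prev i)) →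
                    InBoard w → OnEdgeLine e w → Parallel (w -ₚ corner i) →
                    Σ (Config B m (2 ℕ.+ q)) λ z → IsVertex B m (2 ℕ.+ q) z × z zero ≡ w
  antipode-vertex {q} {i} {e} {w} i∦ prev∦ w∈B w-on-e w∥i = z , (z∈B , M , F , z-satisfies , z-unique) , refl
    where
      z : Config B m (2 ℕ.+ q)
      z zero    = w
      z (suc _) = corner i
      z∈B : ∀ b → InBoard (z b)
      z∈B zero    = w∈B
      z∈B (suc _) = corner-inBoard i
      M : List (Fin (2 ℕ.+ q) × Fin (2 ℕ.+ q))
      M = (zero , suc zero) ∷ []
      F : List (Fin (2 ℕ.+ q) × Fin n)
      F = (zero , e) ∷ cornerFacets suc i
      z-satisfies : Satisfies B m M F z
      z-satisfies = parallel⇒moveRel {w} {corner i} (parallel-sym {corner i} {w} w∥i) All.∷ All.[]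
                  , w-on-e All.∷ proj₂ (cornerFacets-satisfied suc i {z} (λ _ → refl))
      z-unique : ∀ w′ → Satisfies B m M F w′ → ∀ b → w′ b ≡ z b
      z-unique w′ (w′-move All.∷ _ , w′-on-e All.∷ w′-at-i) = w′≡z
        where
          w′≡z : ∀ b → w′ b ≡ z b
          w′≡z (suc b) = cornerFacets-force suc i {w′} (All.[] , w′-at-i) b
          w′≡z zero = edgeLine∩parallelLine-unique {e} {w} {w′ zero}
                        (aligned-edgeLine-nonParallel {i} {e} {w} i∦ prev∦ w-on-e w∥i)
                        w-on-e w′-on-e (parallel-trans {w} {corner i} {w′ zero} (parallel-sym {corner i} {w} w∥i) w′₀∥i)
            where
              w′₀∥i : Parallel (w′ zero -ₚ corner i)
              w′₀∥i = parallel-sym {w′ zero} {corner i}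
                        (subst (λ p → Parallel (p -ₚ w′ zero)) (w′≡z (suc zero))
                          (moveRel⇒parallel {w′ zero} {w′ (suc zero)} w′-move))

-- Denominators

CommonMultiple : {A : Set} → (A → Set) → (A → ℕ) → ℕ → Set
CommonMultiple P f N = ∀ x → P x → f x ∣ N

IsLCMOver-⇔ : ∀ {A A′ : Set} {P : A → Set} {f : A → ℕ} {P′ : A′ → Set} {f′ : A′ → ℕ} →
              (∀ N → CommonMultiple P f N → CommonMultiple P′ f′ N) →
              (∀ N → CommonMultiple P′ f′ N → CommonMultiple P f N) →
              ∀ D → IsLCMOver P f D ⇔ IsLCMOver P′ f′ D
IsLCMOver-⇔ to from D = mk⇔ (λ (D-mult , D-least) → to D D-mult , λ N N-mult → D-least N (from N N-mult))
                            (λ (D-mult , D-least) → from D D-mult , λ N N-mult → D-least N (to N N-mult))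

module _ {q} (z : Fin q → Pt) where
  private
    lcmOver : List (Fin q) → ℕ
    lcmOver = foldr (λ i acc → lcm (ptDen (z i)) acc) 1

    lcmOver-∣ : ∀ {a} xs → a ∈ xs → ptDen (z a) ∣ lcmOver xs
    lcmOver-∣ (x ∷ xs) (here refl) = m∣lcm[m,n] (ptDen (z x)) (lcmOver xs)
    lcmOver-∣ (x ∷ xs) (there a∈xs) = ∣-trans (lcmOver-∣ xs a∈xs) (n∣lcm[m,n] (ptDen (z x)) (lcmOver xs))

    lcmOver-least : ∀ {N} xs → (∀ a → ptDen (z a) ∣ N) → lcmOver xs ∣ N
    lcmOver-least {N} []       _     = 1∣ N
    lcmOver-least     (x ∷ xs) z∣N   = lcm-least (z∣N x) (lcmOver-least xs z∣N)

  ptDen∣cfgDen : ∀ a → ptDen (z a) ∣ cfgDen z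
  ptDen∣cfgDen a = lcmOver-∣ (allFin q) (∈-allFin a)

  cfgDen-least : ∀ {N} → (∀ a → ptDen (z a) ∣ N) → cfgDen z ∣ N
  cfgDen-least = lcmOver-least (allFin q)

module Denominators (B : Board) (m : Move) where
  open Board B
  open VertexConstructions B m

  corner∣vertexMultiple : ∀ {q N} → CommonMultiple (IsVertex B m (1 ℕ.+ q)) cfgDen N → ∀ i → ptDen (corner i) ∣ N
  corner∣vertexMultiple {q} N-mult i =
    ∣-trans (ptDen∣cfgDen {1 ℕ.+ q} (λ _ → corner i) zero) (N-mult _ (corner-vertex (1 ℕ.+ q) i))

  vertexMultiple⇒cornerMultiple : ∀ q N → CommonMultiple (IsVertex B m (1 ℕ.+ q)) cfgDen N →
                                  CommonMultiple (IsCorner B m) ptDen N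
  vertexMultiple⇒cornerMultiple q N N-mult _ (i , refl) = corner∣vertexMultiple N-mult i

  cornerMultiple⇒vertex₁Multiple : ∀ N → CommonMultiple (IsCorner B m) ptDen N →
                                   CommonMultiple (IsVertex B m 1) cfgDen N
  cornerMultiple⇒vertex₁Multiple N N-mult z z-vertex =
    cfgDen-least z (λ a → N-mult (z a) (singlePiece-corner B m z z-vertex a))

  vertexMultiple⇒antipodeMultiple : ∀ q N → CommonMultiple (IsVertex B m (2 ℕ.+ q)) cfgDen N →
                                    CommonMultiple (IsCornerOrAntipode B m) ptDen N
  vertexMultiple⇒antipodeMultiple q N N-mult _ (inj₁ (i , refl))                    = corner∣vertexMultiple N-mult i
  vertexMultiple⇒antipodeMultiple q N N-mult _ (inj₂ (i , inj₁ (_ , refl)))         = corner∣vertexMultiple N-mult (next i)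
  vertexMultiple⇒antipodeMultiple q N N-mult _ (inj₂ (i , inj₂ (inj₁ (_ , refl)))) = corner∣vertexMultiple N-mult (prev i)
  vertexMultiple⇒antipodeMultiple q N N-mult w (inj₂ (i , inj₂ (inj₂ (i∦ , prev∦ , (w∈B , e , w-on-e) , _ , w∥i)))) =
    divides (antipode-vertex {q} {i} {e} {w} i∦ prev∦ w∈B w-on-e w∥i)
    where
      divides : (Σ (Config B m (2 ℕ.+ q)) λ z → IsVertex B m (2 ℕ.+ q) z × z zero ≡ w) → ptDen w ∣ N
      divides (z , z-vertex , z₀≡w) =
        subst (λ p → ptDen p ∣ N) z₀≡w (∣-trans (ptDen∣cfgDen {2 ℕ.+ q} z zero) (N-mult z z-vertex))

  antipodeMultiple⇒vertexMultiple : ∀ q N → CommonMultiple (IsCornerOrAntipode B m) ptDen N →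
                                    CommonMultiple (IsVertex B m q) cfgDen N
  antipodeMultiple⇒vertexMultiple q N N-mult z z-vertex =
    cfgDen-least z (λ a → N-mult (z a) (VertexRigidity.piece-cornerOrAntipode B m z z-vertex a))

proposition3p1 : (B : Board) (m : Move) (q : ℕ) (D : ℕ) →
    (q ≡ 1 → (IsIOPDenominator B m q D ⇔ IsLCMOver (IsCorner B m) ptDen D)) ×
    (2 ≤ q → (IsIOPDenominator B m q D ⇔ IsLCMOver (IsCornerOrAntipode B m) ptDen D))
proposition3p1 B m q D = one-piece , several-pieces
  where
    open Denominators B m
    one-piece : q ≡ 1 → IsIOPDenominator B m q D ⇔ IsLCMOver (IsCorner B m) ptDen D
    one-piece refl = IsLCMOver-⇔ (vertexMultiple⇒cornerMultiple 0) cornerMultiple⇒vertex₁Multiple D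
    several-pieces : 2 ≤ q → IsIOPDenominator B m q D ⇔ IsLCMOver (IsCornerOrAntipode B m) ptDen D
    several-pieces (s≤s (s≤s _)) = IsLCMOver-⇔ (vertexMultiple⇒antipodeMultiple _) (antipodeMultiple⇒vertexMultiple q) D
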